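{- Let $(G,k)$ be an instance of \textsc{Clique}, and let $G'$, $S=V\cup L\cup N(R)$, $T=V\cup R\cup N(L)$ and $\ell=2\binom{k}{2}+\binom{k}{2}^2+2k$ be as constructed in the context. If $(G,k)$ is a yes-instance, then there is a sequence of at most $\ell$ token jumps transforming $S$ into $T$ in $G'$.
   Context: \textsc{Clique}: given $G$ and $k$, decide whether $G$ has a clique of size $k$. Construction: $V=V(G)$, $m=\binom{k}{2}$. For each edge $e=\{u,v\}$ of $G$ add a vertex $v_e$ adjacent to $u,v$ ($E$ is the set of these). Add a complete bipartite graph with sides $L,R$ of size $m$ each, with every edge subdivided twice, so each $l\in L$, $r\in R$ are joined by a path $l,a,b,r$; $N(L)$ (resp. $N(R)$) is the set of subdivision vertices adjacent to $L$ (resp. $R$); this part has no edges to $V\cup E$. For each $v\in V$ add a vertex $z_v$ adjacent only to $v$. A token jump transforms an independent set $I$ into $(I\setminus\{u\})\cup\{w\}$ with $u\in I$, $w\in V(G')\setminus I$, and the result independent. -}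

module Defs where

open import Data.Nat using (ℕ; zero; suc; _+_; _*_; _≤_)
open import Data.Nat.Combinatorics using (_C_)
open import Data.Fin using (Fin) renaming (_<_ to _<ᶠ_)
open import Data.Bool using (Bool; true; false)
open import Data.Product using (Σ; ∃; ∃-syntax; _×_; _,_)
open import Data.Sum using (_⊎_)
open import Relation.Binary.PropositionalEquality using (_≡_; _≢_)
open import Function.Definitions using (Injective)

record Graph : Set where
  field
    n     : ℕ
    adj   : Fin n → Fin n → Bool
    sym   : ∀ u v → adj u v ≡ adj v u
    irrefl : ∀ v → adj v v ≡ false
open Graph public

HasClique : Graph → ℕ → Set
HasClique G k = Σ (Fin k → Fin (n G)) λ f →
  Injective _≡_ _≡_ f × (∀ i j → i ≢ j → adj G (f i) (f j) ≡ true)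

-- Vertices of G' (for a given m = k choose 2).
--  vV v          : v ∈ V = V(G)
--  vE u v _ _    : the vertex v_e for the edge e = {u,v} (listed once, with u < v)
--  vL l, vR r    : the sides L and R of the complete bipartite graph K_{m,m}
--  vA l r, vB l r: the path l, a, b, r subdividing the edge lr twice
--  vZ v          : the pendant vertex z_v
data V' (G : Graph) (m : ℕ) : Set where
  vV : Fin (n G) → V' G m
  vE : (u v : Fin (n G)) → u <ᶠ v → adj G u v ≡ true → V' G m
  vL : Fin m → V' G m
  vR : Fin m → V' G m
  vA : Fin m → Fin m → V' G m
  vB : Fin m → Fin m → V' G m
  vZ : Fin (n G) → V' G m

data Arc {G : Graph} {m : ℕ} : V' G m → V' G m → Set where
  eu : ∀ u v p q → Arc (vE u v p q) (vV u)
  ev : ∀ u v p q → Arc (vE u v p q) (vV v)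
  la : ∀ l r → Arc (vL l) (vA l r)
  ab : ∀ l r → Arc (vA l r) (vB l r)
  br : ∀ l r → Arc (vB l r) (vR r)
  zv : ∀ v → Arc (vZ v) (vV v)

Adj' : {G : Graph} {m : ℕ} → V' G m → V' G m → Set
Adj' x y = Arc x y ⊎ Arc y x

VSet : Graph → ℕ → Set
VSet G m = V' G m → Bool

Independent : {G : Graph} {m : ℕ} → VSet G m → Set
Independent {G} {m} I = ∀ (x y : V' G m) → Adj' x y → I x ≡ true → I y ≡ false

TokenJump : {G : Graph} {m : ℕ} → VSet G m → VSet G m → Set
TokenJump {G} {m} I J = Σ (V' G m) λ u → Σ (V' G m) λ w →
  I u ≡ true × I w ≡ false × J u ≡ false × J w ≡ true ×
  (∀ x → x ≢ u → x ≢ w → J x ≡ I x) × Independent J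

data Jumps {G : Graph} {m : ℕ} : VSet G m → VSet G m → ℕ → Set where
  done : ∀ {I J} → (∀ x → I x ≡ J x) → Jumps I J zero
  step : ∀ {I K J t} → TokenJump I K → Jumps K J t → Jumps I J (suc t)

mOf : ℕ → ℕ
mOf k = k C 2

ℓOf : ℕ → ℕ
ℓOf k = 2 * mOf k + mOf k * mOf k + 2 * k

S : (G : Graph) (k : ℕ) → VSet G (mOf k)
S G k (vV _)     = true
S G k (vE _ _ _ _) = false
S G k (vL _)     = true
S G k (vR _)     = false
S G k (vA _ _)   = false
S G k (vB _ _)   = true
S G k (vZ _)     = false

T : (G : Graph) (k : ℕ) → VSet G (mOf k)
T G k (vV _)     = true
T G k (vE _ _ _ _) = false
T G k (vL _)     = false
T G k (vR _)     = true
T G k (vA _ _)   = true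
T G k (vB _ _)   = false
T G k (vZ _)     = false

-- Fix a clique f of size k and an enumeration of its m = k C 2 edges.  Five phases, each
-- moving one token per jump, turn S into T:
--   1. the k tokens on the clique vertices v jump to their pendant vertices z_v;
--   2. the m tokens of L jump to the edge vertices v_e of the clique edges;
--   3. on each of the m² subdivided paths l,a,b,r the token on b jumps to a;
--   4. the m tokens on the v_e jump to R;
--   5. the k parked tokens jump back from z_v to v.
-- Independence is maintained because a token sits on v_e only while both ends of e are
-- empty, and L (resp. R) is empty whenever some a (resp. b) carries a token.  This uses
-- 2k + 2m + m² = ℓ jumps.
module Submission where

open import Defs hiding (sym)
open import Axiom.UniquenessOfIdentityProofs using (module Decidable⇒UIP)
open import Data.Bool using (Bool; true; false; not)
import Data.Bool.Properties as Boolₚ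
open import Data.Empty using (⊥-elim)
open import Data.Fin as Fin using (Fin; toℕ; fromℕ<; splitAt; join; combine; remQuot; cast)
import Data.Fin.Properties as Finₚ
open import Data.Nat using (ℕ; zero; suc; _+_; _*_; _≤_; _<_; _<ᵇ_; z<s; s<s)
import Data.Nat.Properties as ℕₚ
open import Data.Nat.Combinatorics using (_C_; nC1≡n; nCk+nC[k+1]≡[n+1]C[k+1])
open import Data.Nat.Solver using (module +-*-Solver)
open import Data.Product as Product using (Σ; _×_; _,_; proj₁; proj₂; ∃; uncurry)
open import Data.Product.Properties using (≡-dec; ×-≡,≡←≡; ×-≡,≡→≡)
open import Data.Sum as Sum using (_⊎_; inj₁; inj₂; [_,_]′)
open import Function using (_∘_; const; Equivalence)
open import Function.Definitions using (Injective)
open import Relation.Binary.Definitions using (DecidableEquality)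
open import Relation.Binary.PropositionalEquality
open import Relation.Nullary using (yes; no)

module _ {G : Graph} {m : ℕ} where

  TokenJump-respˡ : {I I′ J : VSet G m} → I ≗ I′ → TokenJump I J → TokenJump I′ J
  TokenJump-respˡ I≗I′ (u , w , Iu , Iw , Ju , Jw , J≡I , indJ) =
    u , w , trans (sym (I≗I′ u)) Iu , trans (sym (I≗I′ w)) Iw , Ju , Jw ,
    (λ x x≢u x≢w → trans (J≡I x x≢u x≢w) (I≗I′ x)) , indJ

  Jumps-respˡ : {I I′ J : VSet G m} {t : ℕ} → I ≗ I′ → Jumps I J t → Jumps I′ J t
  Jumps-respˡ I≗I′ (done I≗J)  = done (λ x → trans (sym (I≗I′ x)) (I≗J x))
  Jumps-respˡ I≗I′ (step j js) = step (TokenJump-respˡ I≗I′ j) js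

  Jumps-respʳ : {I J J′ : VSet G m} {t : ℕ} → J ≗ J′ → Jumps I J t → Jumps I J′ t
  Jumps-respʳ J≗J′ (done I≗J)  = done (λ x → trans (I≗J x) (J≗J′ x))
  Jumps-respʳ J≗J′ (step j js) = step j (Jumps-respʳ J≗J′ js)

  Jumps-trans : {I K K′ J : VSet G m} {a b : ℕ} →
                Jumps I K a → K ≗ K′ → Jumps K′ J b → Jumps I J (a + b)
  Jumps-trans (done I≗K)  K≗K′ rest = Jumps-respˡ (λ x → sym (trans (I≗K x) (K≗K′ x))) rest
  Jumps-trans (step j js) K≗K′ rest = step j (Jumps-trans js K≗K′ rest)

  Jumps-chain : (N : ℕ) (φ : ℕ → VSet G m) →
                (∀ c → c < N → TokenJump (φ c) (φ (suc c))) → Jumps (φ 0) (φ N) N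
  Jumps-chain zero    φ jump = done (λ _ → refl)
  Jumps-chain (suc N) φ jump =
    step (jump 0 z<s) (Jumps-chain N (φ ∘ suc) (λ c c<N → jump (suc c) (s<s c<N)))

<ᵇ-irrefl : ∀ n → (n <ᵇ n) ≡ false
<ᵇ-irrefl zero    = refl
<ᵇ-irrefl (suc n) = <ᵇ-irrefl n

n<ᵇ1+n : ∀ n → (n <ᵇ suc n) ≡ true
n<ᵇ1+n zero    = refl
n<ᵇ1+n (suc n) = n<ᵇ1+n n

m<ᵇ1+n≡m<ᵇn : ∀ {m n} → m ≢ n → (m <ᵇ suc n) ≡ (m <ᵇ n)
m<ᵇ1+n≡m<ᵇn {zero}  {zero}  m≢n = ⊥-elim (m≢n refl)
m<ᵇ1+n≡m<ᵇn {zero}  {suc n} m≢n = refl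
m<ᵇ1+n≡m<ᵇn {suc m} {zero}  m≢n = refl
m<ᵇ1+n≡m<ᵇn {suc m} {suc n} m≢n = m<ᵇ1+n≡m<ᵇn (m≢n ∘ cong suc)

-- After c jumps of a phase, the slots 0, …, c − 1 have moved; moved 0 i reduces to false.
moved : {N : ℕ} → ℕ → Fin N → Bool
moved c i = toℕ i <ᵇ c

moved-all : {N : ℕ} (i : Fin N) → moved N i ≡ true
moved-all i = Equivalence.to Boolₚ.T-≡ (ℕₚ.<⇒<ᵇ (Finₚ.toℕ<n i))

module _ {N : ℕ} {x : Fin N} {c : ℕ} (x≡c : toℕ x ≡ c) where

  moved-before : moved c x ≡ false
  moved-before = trans (cong (_<ᵇ c) x≡c) (<ᵇ-irrefl c)

  moved-after : moved (suc c) x ≡ true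
  moved-after = trans (cong (_<ᵇ suc c) x≡c) (n<ᵇ1+n c)

  moved-other : ∀ i → i ≢ x → moved (suc c) i ≡ moved c i
  moved-other i i≢x = m<ᵇ1+n≡m<ᵇn (λ i≡c → i≢x (Finₚ.toℕ-injective (trans i≡c (sym x≡c))))

module Image {B : Set} (_≟_ : DecidableEquality B) {N : ℕ} (g : Fin N → B) where

  image : (Fin N → Bool) → B → Bool
  image P y with Finₚ.any? (λ i → g i ≟ y)
  ... | yes (i , _) = P i
  ... | no _        = false

  image-at : Injective _≡_ _≡_ g → ∀ P x → image P (g x) ≡ P x
  image-at g-inj P x with Finₚ.any? (λ i → g i ≟ g x)
  ... | yes (i , gi≡gx) = cong P (g-inj gi≡gx)
  ... | no ∄i           = ⊥-elim (∄i (x , refl))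

  image-update : ∀ {P P′} x → (∀ i → i ≢ x → P′ i ≡ P i) →
                 ∀ y → y ≢ g x → image P′ y ≡ image P y
  image-update x P′≡P y y≢gx with Finₚ.any? (λ i → g i ≟ y)
  ... | yes (i , gi≡y) = P′≡P i (λ i≡x → y≢gx (trans (sym gi≡y) (cong g i≡x)))
  ... | no _           = refl

  image-cong : ∀ {P P′} → P ≗ P′ → image P ≗ image P′
  image-cong P≗P′ y with Finₚ.any? (λ i → g i ≟ y)
  ... | yes (i , _) = P≗P′ i
  ... | no _        = refl

  image-empty : ∀ P → (∀ i → P i ≡ false) → ∀ y → image P y ≡ false
  image-empty P P≡false y with Finₚ.any? (λ i → g i ≟ y)
  ... | yes (i , _) = P≡false i
  ... | no _        = refl

  image-true : ∀ P y → image P y ≡ true → ∃ λ i → g i ≡ y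
  image-true P y Py with Finₚ.any? (λ i → g i ≟ y)
  ... | yes found = found
  image-true P y () | no _

pairCount : ℕ → ℕ
pairCount zero    = zero
pairCount (suc k) = k + pairCount k

pairCount≡C2 : ∀ k → pairCount k ≡ k C 2
pairCount≡C2 zero    = refl
pairCount≡C2 (suc k) =
  trans (cong₂ _+_ (sym (nC1≡n k)) (pairCount≡C2 k)) (nCk+nC[k+1]≡[n+1]C[k+1] k 1)

-- The pairs a < b of Fin (suc k) are the pairs (0, 1 + i) followed by the shifted pairs of Fin k.
ascendingPairs  : ∀ k → Fin (pairCount k) → Fin k × Fin k
ascendingPairs⊎ : ∀ k → Fin k ⊎ Fin (pairCount k) → Fin (suc k) × Fin (suc k)
ascendingPairs (suc k) = ascendingPairs⊎ k ∘ splitAt k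
ascendingPairs⊎ k = [ (λ i → Fin.zero , Fin.suc i) , Product.map Fin.suc Fin.suc ∘ ascendingPairs k ]′

ascendingPairs-<  : ∀ k x → proj₁ (ascendingPairs k x) Fin.< proj₂ (ascendingPairs k x)
ascendingPairs⊎-< : ∀ k s → proj₁ (ascendingPairs⊎ k s) Fin.< proj₂ (ascendingPairs⊎ k s)
ascendingPairs-< (suc k) x = ascendingPairs⊎-< k (splitAt k x)
ascendingPairs⊎-< k (inj₁ i) = z<s
ascendingPairs⊎-< k (inj₂ y) = s<s (ascendingPairs-< k y)

ascendingPairs-injective  : ∀ k → Injective _≡_ _≡_ (ascendingPairs k)
ascendingPairs⊎-injective : ∀ k → Injective _≡_ _≡_ (ascendingPairs⊎ k)
ascendingPairs-injective (suc k) {x} {y} e = begin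
  x                           ≡⟨ Finₚ.join-splitAt k (pairCount k) x ⟨
  join k _ (splitAt k x)      ≡⟨ cong (join k _) (ascendingPairs⊎-injective k {splitAt k x} {splitAt k y} e) ⟩
  join k _ (splitAt k y)      ≡⟨ Finₚ.join-splitAt k (pairCount k) y ⟩
  y                           ∎
  where open ≡-Reasoning
ascendingPairs⊎-injective k {inj₁ i} {inj₁ j} e = cong inj₁ (Finₚ.suc-injective (cong proj₂ e))
ascendingPairs⊎-injective k {inj₂ y} {inj₂ z} e = cong inj₂ (ascendingPairs-injective k
  (×-≡,≡→≡ (Product.map Finₚ.suc-injective Finₚ.suc-injective (×-≡,≡←≡ e))))
ascendingPairs⊎-injective k {inj₁ i} {inj₂ z} ()
ascendingPairs⊎-injective k {inj₂ y} {inj₁ j} ()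

cast-injective : ∀ {a b} (eq : a ≡ b) → Injective _≡_ _≡_ (cast eq)
cast-injective eq {x} {y} e =
  Finₚ.toℕ-injective (trans (sym (Finₚ.toℕ-cast eq x)) (trans (cong toℕ e) (Finₚ.toℕ-cast eq y)))

module _ {n : ℕ} where

  sort : Fin n → Fin n → Fin n × Fin n
  sort u v with u Finₚ.<? v
  ... | yes _ = u , v
  ... | no _  = v , u

  sort-< : ∀ {u v} → u ≢ v → proj₁ (sort u v) Fin.< proj₂ (sort u v)
  sort-< {u} {v} u≢v with u Finₚ.<? v
  ... | yes u<v = u<v
  ... | no u≮v  = ℕₚ.≤∧≢⇒< (ℕₚ.≮⇒≥ u≮v) (u≢v ∘ sym ∘ Finₚ.toℕ-injective)

  sort-preserves : ∀ (P : Fin n → Set) {u v} → P u → P v → P (proj₁ (sort u v)) × P (proj₂ (sort u v))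
  sort-preserves P {u} {v} Pu Pv with u Finₚ.<? v
  ... | yes _ = Pu , Pv
  ... | no _  = Pv , Pu

  sort-preserves₂ : ∀ (R : Fin n → Fin n → Set) → (∀ {u v} → R u v → R v u) →
                    ∀ {u v} → R u v → uncurry R (sort u v)
  sort-preserves₂ R R-sym {u} {v} Ruv with u Finₚ.<? v
  ... | yes _ = Ruv
  ... | no _  = R-sym Ruv

  sort-injective : ∀ {u v u′ v′} → sort u v ≡ sort u′ v′ →
                   (u ≡ u′ × v ≡ v′) ⊎ (u ≡ v′ × v ≡ u′)
  sort-injective {u} {v} {u′} {v′} e with u Finₚ.<? v | u′ Finₚ.<? v′
  ... | yes _ | yes _ = inj₁ (×-≡,≡←≡ e)
  ... | yes _ | no _  = inj₂ (×-≡,≡←≡ e)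
  ... | no _  | yes _ = inj₂ (Product.swap (×-≡,≡←≡ e))
  ... | no _  | no _  = inj₁ (Product.swap (×-≡,≡←≡ e))

ascending-unordered : ∀ {k} {a b a′ b′ : Fin k} → a Fin.< b → a′ Fin.< b′ →
                      (a ≡ a′ × b ≡ b′) ⊎ (a ≡ b′ × b ≡ a′) → (a , b) ≡ (a′ , b′)
ascending-unordered a<b a′<b′ (inj₁ same)          = ×-≡,≡→≡ same
ascending-unordered a<b a′<b′ (inj₂ (refl , refl)) = ⊥-elim (ℕₚ.<-asym a<b a′<b′)

vE-cong : ∀ {G m u v u′ v′} {p q p′ q′} → u ≡ u′ → v ≡ v′ → vE {G} {m} u v p q ≡ vE u′ v′ p′ q′
vE-cong {p = p} {q} {p′} {q′} refl refl =
  cong₂ (vE _ _) (ℕₚ.<-irrelevant p p′) (Decidable⇒UIP.≡-irrelevant Boolₚ._≟_ q q′)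

NotBoth : Bool → Bool → Set
NotBoth a b = a ≡ true → b ≡ false

NotBoth-sym : ∀ {a b} → NotBoth a b → NotBoth b a
NotBoth-sym {true}  {true}  h _ = h refl
NotBoth-sym {false} {_}     h _ = refl
NotBoth-sym {true}  {false} h ()

NotBoth-falseˡ : ∀ {b} → NotBoth false b
NotBoth-falseˡ ()

NotBoth-falseʳ : ∀ {a} → NotBoth a false
NotBoth-falseʳ _ = refl

NotBoth-not : ∀ b → NotBoth b (not b)
NotBoth-not true _ = refl
NotBoth-not false ()

record Marking (G : Graph) (m : ℕ) : Set where
  field
    atV atZ : Fin (n G) → Bool
    atE     : Fin (n G) → Fin (n G) → Bool
    atL atR : Fin m → Bool
    atA atB : Fin m → Fin m → Bool

module _ {G : Graph} {m : ℕ} where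
  open Marking

  ⟦_⟧ : Marking G m → VSet G m
  ⟦ M ⟧ (vV v)       = atV M v
  ⟦ M ⟧ (vE u v _ _) = atE M u v
  ⟦ M ⟧ (vL l)       = atL M l
  ⟦ M ⟧ (vR r)       = atR M r
  ⟦ M ⟧ (vA l r)     = atA M l r
  ⟦ M ⟧ (vB l r)     = atB M l r
  ⟦ M ⟧ (vZ v)       = atZ M v

  ⟦⟧-independent : (M : Marking G m) →
    (∀ u v → NotBoth (atE M u v) (atV M u)) → (∀ u v → NotBoth (atE M u v) (atV M v)) →
    (∀ l r → NotBoth (atL M l) (atA M l r)) → (∀ l r → NotBoth (atA M l r) (atB M l r)) →
    (∀ l r → NotBoth (atB M l r) (atR M r)) → (∀ v → NotBoth (atZ M v) (atV M v)) →
    Independent ⟦ M ⟧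
  ⟦⟧-independent M eu-ok ev-ok la-ok ab-ok br-ok zv-ok = independent
    where
    independent : Independent ⟦ M ⟧
    independent _ _ (inj₁ (eu u v _ _)) = eu-ok u v
    independent _ _ (inj₁ (ev u v _ _)) = ev-ok u v
    independent _ _ (inj₁ (la l r))     = la-ok l r
    independent _ _ (inj₁ (ab l r))     = ab-ok l r
    independent _ _ (inj₁ (br l r))     = br-ok l r
    independent _ _ (inj₁ (zv v))       = zv-ok v
    independent _ _ (inj₂ (eu u v _ _)) = NotBoth-sym (eu-ok u v)
    independent _ _ (inj₂ (ev u v _ _)) = NotBoth-sym (ev-ok u v)
    independent _ _ (inj₂ (la l r))     = NotBoth-sym (la-ok l r)
    independent _ _ (inj₂ (ab l r))     = NotBoth-sym (ab-ok l r)
    independent _ _ (inj₂ (br l r))     = NotBoth-sym (br-ok l r)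
    independent _ _ (inj₂ (zv v))       = NotBoth-sym (zv-ok v)

module Reconfiguration (G : Graph) (k : ℕ) (clique : HasClique G k) where

  m : ℕ
  m = mOf k

  f : Fin k → Fin (n G)
  f = proj₁ clique

  f-injective : Injective _≡_ _≡_ f
  f-injective = proj₁ (proj₂ clique)

  f-adjacent : ∀ i j → i ≢ j → adj G (f i) (f j) ≡ true
  f-adjacent = proj₂ (proj₂ clique)

  pairIndex : Fin m → Fin (pairCount k)
  pairIndex = cast (sym (pairCount≡C2 k))

  cliquePair : Fin m → Fin k × Fin k
  cliquePair = ascendingPairs k ∘ pairIndex

  cliquePair-≢ : ∀ x → proj₁ (cliquePair x) ≢ proj₂ (cliquePair x)
  cliquePair-≢ x e = ℕₚ.<-irrefl (cong toℕ e) (ascendingPairs-< k (pairIndex x))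

  cliqueEdge : Fin m → Fin (n G) × Fin (n G)
  cliqueEdge x = sort (f (proj₁ (cliquePair x))) (f (proj₂ (cliquePair x)))

  cliqueEdge-< : ∀ x → proj₁ (cliqueEdge x) Fin.< proj₂ (cliqueEdge x)
  cliqueEdge-< x = sort-< (cliquePair-≢ x ∘ f-injective)

  cliqueEdge-adj : ∀ x → uncurry (adj G) (cliqueEdge x) ≡ true
  cliqueEdge-adj x = sort-preserves₂ (λ u v → adj G u v ≡ true) (λ {u} {v} h → trans (Graph.sym G v u) h)
                                     (f-adjacent _ _ (cliquePair-≢ x))

  cliqueEdge-injective : Injective _≡_ _≡_ cliqueEdge
  cliqueEdge-injective {x} {y} e =
    cast-injective (sym (pairCount≡C2 k)) (ascendingPairs-injective k
      (ascending-unordered (ascendingPairs-< k (pairIndex x)) (ascendingPairs-< k (pairIndex y))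
        (Sum.map (Product.map f-injective f-injective) (Product.map f-injective f-injective)
          (sort-injective e))))

  edgeVertex : Fin m → V' G m
  edgeVertex x = vE (proj₁ (cliqueEdge x)) (proj₂ (cliqueEdge x)) (cliqueEdge-< x) (cliqueEdge-adj x)

  module Clique = Image Finₚ._≟_ f
  module Edges  = Image (≡-dec Finₚ._≟_ Finₚ._≟_) cliqueEdge

  inClique : Fin (n G) → Bool
  inClique = Clique.image (const true)

  cliqueEdge-inClique : ∀ x → inClique (proj₁ (cliqueEdge x)) ≡ true × inClique (proj₂ (cliqueEdge x)) ≡ true
  cliqueEdge-inClique x =
    sort-preserves (λ u → inClique u ≡ true) (Clique.image-at f-injective _ _) (Clique.image-at f-injective _ _)

  edgeToken-inClique₁ : ∀ P u v → NotBoth (Edges.image P (u , v)) (not (inClique u))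
  edgeToken-inClique₁ P u v h with Edges.image-true P (u , v) h
  ... | x , refl = cong not (proj₁ (cliqueEdge-inClique x))

  edgeToken-inClique₂ : ∀ P u v → NotBoth (Edges.image P (u , v)) (not (inClique v))
  edgeToken-inClique₂ P u v h with Edges.image-true P (u , v) h
  ... | x , refl = cong not (proj₂ (cliqueEdge-inClique x))

  parkClique : ℕ → Marking G m
  parkClique c = record
    { atV = not ∘ Clique.image (moved c) ; atZ = Clique.image (moved c) ; atE = λ _ _ → false
    ; atL = const true ; atR = const false ; atA = λ _ _ → false ; atB = λ _ _ → true }

  fillEdges : ℕ → Marking G m
  fillEdges c = record
    { atV = not ∘ inClique ; atZ = inClique ; atE = λ u v → Edges.image (moved c) (u , v)
    ; atL = not ∘ moved c ; atR = const false ; atA = λ _ _ → false ; atB = λ _ _ → true }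

  crossPaths : ℕ → Marking G m
  crossPaths c = record
    { atV = not ∘ inClique ; atZ = inClique ; atE = λ u v → Edges.image (const true) (u , v)
    ; atL = const false ; atR = const false
    ; atA = λ l r → moved c (combine l r) ; atB = λ l r → not (moved c (combine l r)) }

  drainEdges : ℕ → Marking G m
  drainEdges c = record
    { atV = not ∘ inClique ; atZ = inClique ; atE = λ u v → Edges.image (not ∘ moved c) (u , v)
    ; atL = const false ; atR = moved c ; atA = λ _ _ → true ; atB = λ _ _ → false }

  unparkClique : ℕ → Marking G m
  unparkClique c = record
    { atV = not ∘ Clique.image (not ∘ moved c) ; atZ = Clique.image (not ∘ moved c)
    ; atE = λ _ _ → false ; atL = const false ; atR = const true
    ; atA = λ _ _ → true ; atB = λ _ _ → false }

  parkClique-independent : ∀ c → Independent ⟦ parkClique c ⟧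
  parkClique-independent c = ⟦⟧-independent _ (λ _ _ → NotBoth-falseˡ) (λ _ _ → NotBoth-falseˡ)
    (λ _ _ → NotBoth-falseʳ) (λ _ _ → NotBoth-falseˡ) (λ _ _ → NotBoth-falseʳ) (λ _ → NotBoth-not _)

  fillEdges-independent : ∀ c → Independent ⟦ fillEdges c ⟧
  fillEdges-independent c = ⟦⟧-independent _ (edgeToken-inClique₁ _) (edgeToken-inClique₂ _)
    (λ _ _ → NotBoth-falseʳ) (λ _ _ → NotBoth-falseˡ) (λ _ _ → NotBoth-falseʳ) (λ _ → NotBoth-not _)

  crossPaths-independent : ∀ c → Independent ⟦ crossPaths c ⟧
  crossPaths-independent c = ⟦⟧-independent _ (edgeToken-inClique₁ _) (edgeToken-inClique₂ _)
    (λ _ _ → NotBoth-falseˡ) (λ _ _ → NotBoth-not _) (λ _ _ → NotBoth-falseʳ) (λ _ → NotBoth-not _)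

  drainEdges-independent : ∀ c → Independent ⟦ drainEdges c ⟧
  drainEdges-independent c = ⟦⟧-independent _ (edgeToken-inClique₁ _) (edgeToken-inClique₂ _)
    (λ _ _ → NotBoth-falseˡ) (λ _ _ → NotBoth-falseʳ) (λ _ _ → NotBoth-falseˡ) (λ _ → NotBoth-not _)

  unparkClique-independent : ∀ c → Independent ⟦ unparkClique c ⟧
  unparkClique-independent c = ⟦⟧-independent _ (λ _ _ → NotBoth-falseˡ) (λ _ _ → NotBoth-falseˡ)
    (λ _ _ → NotBoth-falseˡ) (λ _ _ → NotBoth-falseʳ) (λ _ _ → NotBoth-falseˡ) (λ _ → NotBoth-not _)

  parkClique-step : ∀ c → c < k → TokenJump ⟦ parkClique c ⟧ ⟦ parkClique (suc c) ⟧
  parkClique-step c c<k =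
    vV (f x) , vZ (f x) , cong not before , before , cong not after , after , unchanged ,
    parkClique-independent (suc c)
    where
    x   = fromℕ< c<k
    x≡c = Finₚ.toℕ-fromℕ< c<k
    before : Clique.image (moved c) (f x) ≡ false
    before = trans (Clique.image-at f-injective _ x) (moved-before x≡c)
    after : Clique.image (moved (suc c)) (f x) ≡ true
    after = trans (Clique.image-at f-injective _ x) (moved-after x≡c)
    unchanged : ∀ y → y ≢ vV (f x) → y ≢ vZ (f x) → ⟦ parkClique (suc c) ⟧ y ≡ ⟦ parkClique c ⟧ y
    unchanged (vV v) y≢u _ = cong not (Clique.image-update x (moved-other x≡c) v (y≢u ∘ cong vV))
    unchanged (vZ v) _ y≢w = Clique.image-update x (moved-other x≡c) v (y≢w ∘ cong vZ)
    unchanged (vE _ _ _ _) _ _ = refl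
    unchanged (vL _)       _ _ = refl
    unchanged (vR _)       _ _ = refl
    unchanged (vA _ _)     _ _ = refl
    unchanged (vB _ _)     _ _ = refl

  fillEdges-step : ∀ c → c < m → TokenJump ⟦ fillEdges c ⟧ ⟦ fillEdges (suc c) ⟧
  fillEdges-step c c<m =
    vL x , edgeVertex x , cong not (moved-before x≡c) , trans hit (moved-before x≡c) ,
    cong not (moved-after x≡c) , trans hit (moved-after x≡c) , unchanged , fillEdges-independent (suc c)
    where
    x   = fromℕ< c<m
    x≡c = Finₚ.toℕ-fromℕ< c<m
    hit : ∀ {P} → Edges.image P (cliqueEdge x) ≡ P x
    hit = Edges.image-at cliqueEdge-injective _ x
    unchanged : ∀ y → y ≢ vL x → y ≢ edgeVertex x → ⟦ fillEdges (suc c) ⟧ y ≡ ⟦ fillEdges c ⟧ y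
    unchanged (vL l) y≢u _ = cong not (moved-other x≡c l (y≢u ∘ cong vL))
    unchanged (vE u v _ _) _ y≢w = Edges.image-update x (moved-other x≡c) (u , v)
      (λ e → y≢w (vE-cong (cong proj₁ e) (cong proj₂ e)))
    unchanged (vV _)   _ _ = refl
    unchanged (vZ _)   _ _ = refl
    unchanged (vR _)   _ _ = refl
    unchanged (vA _ _) _ _ = refl
    unchanged (vB _ _) _ _ = refl

  crossPaths-step : ∀ c → c < m * m → TokenJump ⟦ crossPaths c ⟧ ⟦ crossPaths (suc c) ⟧
  crossPaths-step c c<mm =
    vB l r , vA l r , cong not (moved-before lr≡c) , moved-before lr≡c ,
    cong not (moved-after lr≡c) , moved-after lr≡c , unchanged , crossPaths-independent (suc c)
    where
    x = fromℕ< c<mm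
    l = proj₁ (remQuot {m} m x)
    r = proj₂ (remQuot {m} m x)
    lr≡c : toℕ (combine l r) ≡ c
    lr≡c = trans (cong toℕ (Finₚ.combine-remQuot {m} m x)) (Finₚ.toℕ-fromℕ< c<mm)
    unchanged : ∀ y → y ≢ vB l r → y ≢ vA l r → ⟦ crossPaths (suc c) ⟧ y ≡ ⟦ crossPaths c ⟧ y
    unchanged (vA l′ r′) _ y≢w = moved-other lr≡c (combine l′ r′)
      (λ e → y≢w (uncurry (cong₂ vA) (Finₚ.combine-injective l′ r′ l r e)))
    unchanged (vB l′ r′) y≢u _ = cong not (moved-other lr≡c (combine l′ r′)
      (λ e → y≢u (uncurry (cong₂ vB) (Finₚ.combine-injective l′ r′ l r e))))
    unchanged (vV _)       _ _ = refl
    unchanged (vZ _)       _ _ = refl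
    unchanged (vE _ _ _ _) _ _ = refl
    unchanged (vL _)       _ _ = refl
    unchanged (vR _)       _ _ = refl

  drainEdges-step : ∀ c → c < m → TokenJump ⟦ drainEdges c ⟧ ⟦ drainEdges (suc c) ⟧
  drainEdges-step c c<m =
    edgeVertex x , vR x , trans hit (cong not (moved-before x≡c)) , moved-before x≡c ,
    trans hit (cong not (moved-after x≡c)) , moved-after x≡c , unchanged , drainEdges-independent (suc c)
    where
    x   = fromℕ< c<m
    x≡c = Finₚ.toℕ-fromℕ< c<m
    hit : ∀ {P} → Edges.image P (cliqueEdge x) ≡ P x
    hit = Edges.image-at cliqueEdge-injective _ x
    unchanged : ∀ y → y ≢ edgeVertex x → y ≢ vR x → ⟦ drainEdges (suc c) ⟧ y ≡ ⟦ drainEdges c ⟧ y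
    unchanged (vR r) _ y≢w = moved-other x≡c r (y≢w ∘ cong vR)
    unchanged (vE u v _ _) y≢u _ = Edges.image-update x (λ i i≢x → cong not (moved-other x≡c i i≢x)) (u , v)
      (λ e → y≢u (vE-cong (cong proj₁ e) (cong proj₂ e)))
    unchanged (vV _)   _ _ = refl
    unchanged (vZ _)   _ _ = refl
    unchanged (vL _)   _ _ = refl
    unchanged (vA _ _) _ _ = refl
    unchanged (vB _ _) _ _ = refl

  unparkClique-step : ∀ c → c < k → TokenJump ⟦ unparkClique c ⟧ ⟦ unparkClique (suc c) ⟧
  unparkClique-step c c<k =
    vZ (f x) , vV (f x) , before , cong not before , after , cong not after , unchanged ,
    unparkClique-independent (suc c)
    where
    x   = fromℕ< c<k
    x≡c = Finₚ.toℕ-fromℕ< c<k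
    before : Clique.image (not ∘ moved c) (f x) ≡ true
    before = trans (Clique.image-at f-injective _ x) (cong not (moved-before x≡c))
    after : Clique.image (not ∘ moved (suc c)) (f x) ≡ false
    after = trans (Clique.image-at f-injective _ x) (cong not (moved-after x≡c))
    still : ∀ i → i ≢ x → not (moved (suc c) i) ≡ not (moved c i)
    still i i≢x = cong not (moved-other x≡c i i≢x)
    unchanged : ∀ y → y ≢ vZ (f x) → y ≢ vV (f x) → ⟦ unparkClique (suc c) ⟧ y ≡ ⟦ unparkClique c ⟧ y
    unchanged (vV v) _ y≢w = cong not (Clique.image-update x still v (y≢w ∘ cong vV))
    unchanged (vZ v) y≢u _ = Clique.image-update x still v (y≢u ∘ cong vZ)
    unchanged (vE _ _ _ _) _ _ = refl
    unchanged (vL _)       _ _ = refl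
    unchanged (vR _)       _ _ = refl
    unchanged (vA _ _)     _ _ = refl
    unchanged (vB _ _)     _ _ = refl

  S≗parkClique₀ : S G k ≗ ⟦ parkClique 0 ⟧
  S≗parkClique₀ (vV v)       = sym (cong not (Clique.image-empty (moved 0) (λ _ → refl) v))
  S≗parkClique₀ (vZ v)       = sym (Clique.image-empty (moved 0) (λ _ → refl) v)
  S≗parkClique₀ (vE _ _ _ _) = refl
  S≗parkClique₀ (vL _)       = refl
  S≗parkClique₀ (vR _)       = refl
  S≗parkClique₀ (vA _ _)     = refl
  S≗parkClique₀ (vB _ _)     = refl

  parkClique≗fillEdges : ⟦ parkClique k ⟧ ≗ ⟦ fillEdges 0 ⟧
  parkClique≗fillEdges (vV v)       = cong not (Clique.image-cong moved-all v)
  parkClique≗fillEdges (vZ v)       = Clique.image-cong moved-all v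
  parkClique≗fillEdges (vE u v _ _) = sym (Edges.image-empty (moved 0) (λ _ → refl) (u , v))
  parkClique≗fillEdges (vL _)       = refl
  parkClique≗fillEdges (vR _)       = refl
  parkClique≗fillEdges (vA _ _)     = refl
  parkClique≗fillEdges (vB _ _)     = refl

  fillEdges≗crossPaths : ⟦ fillEdges m ⟧ ≗ ⟦ crossPaths 0 ⟧
  fillEdges≗crossPaths (vE u v _ _) = Edges.image-cong moved-all (u , v)
  fillEdges≗crossPaths (vL l)       = cong not (moved-all l)
  fillEdges≗crossPaths (vV _)       = refl
  fillEdges≗crossPaths (vZ _)       = refl
  fillEdges≗crossPaths (vR _)       = refl
  fillEdges≗crossPaths (vA _ _)     = refl
  fillEdges≗crossPaths (vB _ _)     = refl

  crossPaths≗drainEdges : ⟦ crossPaths (m * m) ⟧ ≗ ⟦ drainEdges 0 ⟧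
  crossPaths≗drainEdges (vA l r)     = moved-all (combine l r)
  crossPaths≗drainEdges (vB l r)     = cong not (moved-all (combine l r))
  crossPaths≗drainEdges (vV _)       = refl
  crossPaths≗drainEdges (vZ _)       = refl
  crossPaths≗drainEdges (vE _ _ _ _) = refl
  crossPaths≗drainEdges (vL _)       = refl
  crossPaths≗drainEdges (vR _)       = refl

  drainEdges≗unparkClique : ⟦ drainEdges m ⟧ ≗ ⟦ unparkClique 0 ⟧
  drainEdges≗unparkClique (vE u v _ _) = Edges.image-empty _ (cong not ∘ moved-all) (u , v)
  drainEdges≗unparkClique (vR r)       = moved-all r
  drainEdges≗unparkClique (vV _)       = refl
  drainEdges≗unparkClique (vZ _)       = refl
  drainEdges≗unparkClique (vL _)       = refl
  drainEdges≗unparkClique (vA _ _)     = refl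
  drainEdges≗unparkClique (vB _ _)     = refl

  unparkClique≗T : ⟦ unparkClique k ⟧ ≗ T G k
  unparkClique≗T (vV v)       = cong not (Clique.image-empty _ (cong not ∘ moved-all) v)
  unparkClique≗T (vZ v)       = Clique.image-empty _ (cong not ∘ moved-all) v
  unparkClique≗T (vE _ _ _ _) = refl
  unparkClique≗T (vL _)       = refl
  unparkClique≗T (vR _)       = refl
  unparkClique≗T (vA _ _)     = refl
  unparkClique≗T (vB _ _)     = refl

  S⇝T : Jumps (S G k) (T G k) (k + (m + (m * m + (m + k))))
  S⇝T = Jumps-respˡ (sym ∘ S≗parkClique₀) (Jumps-respʳ unparkClique≗T
    (Jumps-trans (Jumps-chain k (⟦_⟧ ∘ parkClique) parkClique-step) parkClique≗fillEdges
    (Jumps-trans (Jumps-chain m (⟦_⟧ ∘ fillEdges) fillEdges-step) fillEdges≗crossPaths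
    (Jumps-trans (Jumps-chain (m * m) (⟦_⟧ ∘ crossPaths) crossPaths-step) crossPaths≗drainEdges
    (Jumps-trans (Jumps-chain m (⟦_⟧ ∘ drainEdges) drainEdges-step) drainEdges≗unparkClique
    (Jumps-chain k (⟦_⟧ ∘ unparkClique) unparkClique-step))))))

phaseLengths≡ℓ : ∀ k m → k + (m + (m * m + (m + k))) ≡ 2 * m + m * m + 2 * k
phaseLengths≡ℓ = solve 2 (λ k m → k :+ (m :+ (m :* m :+ (m :+ k))) := con 2 :* m :+ m :* m :+ con 2 :* k) refl
  where open +-*-Solver

lemma6p2 : (G : Graph) (k : ℕ) → HasClique G k →
    Σ ℕ (λ t → t ≤ ℓOf k × Jumps {G} {mOf k} (S G k) (T G k) t)
lemma6p2 G k clique = _ , ℕₚ.≤-reflexive (phaseLengths≡ℓ k (mOf k)) , Reconfiguration.S⇝T G k clique
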